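{- Let $n\ge 1$ and let $a_0,a_1,\dots,a_{n-1}$ and $b_1,\dots,b_{n-1}$ be positive integers. Define $p_0=a_0$, $p_1=a_0a_1+b_1$, and $p_k=a_kp_{k-1}+b_kp_{k-2}$ for $k\ge 2$ (so that $p_k$ is the numerator, computed by this recurrence, of the convergent $a_0+\cfrac{b_1}{a_1+\cfrac{b_2}{\ddots+\cfrac{b_k}{a_k}}}$). Then $$Z\bigl(D_n(a_0,a_1,\dots,a_{n-1};b_1,\dots,b_{n-1})\bigr)=p_{n-1}.$$
   Context: For positive integers $x_1,\dots,x_n$ and $y_1,\dots,y_{n-1}$, the caterpillar-bond graph $D_n(x_1,\dots,x_n;y_1,\dots,y_{n-1})$ is the multigraph with a central path of vertices $v_1,\dots,v_n$, where for each $k=1,\dots,n-1$ the vertices $v_k$ and $v_{k+1}$ are joined by exactly $y_k$ parallel edges, and where each $v_k$ ($1\le k\le n$) additionally has exactly $x_k-1$ pendant vertices (leaves) attached to it by single edges; there are no other vertices or edges. For a finite multigraph $G$, the topological index (Hosoya index) is $Z(G)=\sum_{k\ge0}p(G,k)$, where $p(G,k)$ is the number of sets of $k$ pairwise disjoint edges of $G$ ($p(G,0)=1$), parallel edges being counted as distinct edges. -}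

module Defs where

open import Data.Nat using (ℕ; zero; suc; _+_; _*_; _∸_)
open import Data.Fin using (Fin; toℕ; inject₁) renaming (zero to fzero; suc to fsuc)
import Data.Fin.Properties as FinP
open import Data.Fin.Subset using (Subset; _∈_; ∣_∣; inside; outside)
open import Data.Fin.Subset.Properties using (_∈?_)
open import Data.List using (List; []; _∷_; _++_; map; length; lookup; filter; allFin; concatMap; replicate)
open import Data.Vec using (Vec) renaming ([] to []ᵥ; _∷_ to _∷ᵥ_)
open import Data.Product using (Σ; _×_; _,_; proj₁; proj₂)
import Data.Product.Properties as ProdP
open import Data.Sum using (_⊎_; inj₁; inj₂)
import Data.Sum.Properties as SumP
open import Relation.Binary.PropositionalEquality using (_≡_; _≢_)
open import Relation.Binary.Definitions using (DecidableEquality)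
open import Relation.Nullary using (Dec; ¬?)
open import Relation.Nullary.Decidable using (_×-dec_; _→-dec_)

-- Finite multigraphs: a vertex type with decidable equality and a
-- finite list of edges (pairs of endpoints).  Parallel edges are
-- distinct list entries, hence counted as distinct edges.

record Multigraph : Set₁ where
  field
    V     : Set
    _≟V_  : DecidableEquality V
    edges : List (V × V)

  E : ℕ
  E = length edges

  ends : Fin E → V × V
  ends = lookup edges

open Multigraph public

Disjoint : {V : Set} → V × V → V × V → Set
Disjoint (u , v) (u' , v') = (u ≢ u') × (u ≢ v') × (v ≢ u') × (v ≢ v')

disjoint? : {V : Set} → DecidableEquality V → (e f : V × V) → Dec (Disjoint e f)
disjoint? _≟_ (u , v) (u' , v') =
  ¬? (u ≟ u') ×-dec ¬? (u ≟ v') ×-dec ¬? (v ≟ u') ×-dec ¬? (v ≟ v')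

PairwiseDisjoint : (G : Multigraph) → Subset (E G) → Set
PairwiseDisjoint G S =
  ∀ i j → i ∈ S → j ∈ S → i ≢ j → Disjoint (ends G i) (ends G j)

pairwiseDisjoint? : (G : Multigraph) (S : Subset (E G)) → Dec (PairwiseDisjoint G S)
pairwiseDisjoint? G S =
  FinP.all? λ i → FinP.all? λ j →
    (i ∈? S) →-dec (j ∈? S) →-dec ¬? (i FinP.≟ j) →-dec
      disjoint? (_≟V_ G) (ends G i) (ends G j)

allSubsets : (m : ℕ) → List (Subset m)
allSubsets zero    = []ᵥ ∷ []
allSubsets (suc m) = map (outside ∷ᵥ_) (allSubsets m) ++ map (inside ∷ᵥ_) (allSubsets m)

IsKMatching : (G : Multigraph) → ℕ → Subset (E G) → Set
IsKMatching G k S = PairwiseDisjoint G S × (∣ S ∣ ≡ k)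

p : Multigraph → ℕ → ℕ
p G k = length (filter (λ S → pairwiseDisjoint? G S ×-dec (∣ S ∣ Data.Nat.≟ k)) (allSubsets (E G)))
  where import Data.Nat

-- Hosoya index Z(G) = Σ_{k ≥ 0} p(G,k); p(G,k) = 0 for k > |E(G)|,
-- so the sum may be truncated at k = |E(G)|.
sumUpTo : (ℕ → ℕ) → ℕ → ℕ
sumUpTo f zero    = f zero
sumUpTo f (suc k) = sumUpTo f k + f (suc k)

Z : Multigraph → ℕ
Z G = sumUpTo (p G) (E G)

-- Parameters are given as sequences x y : ℕ → ℕ, 1-based as in the
-- paper (only x 1 .. x n and y 1 .. y (n-1) are used).
-- Path vertex v_k (1 ≤ k ≤ n) is  inj₁ i  with toℕ i + 1 = k;
-- the leaves at v_k are  inj₂ (i , j)  with j : Fin (x k ∸ 1).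

DVertex : (n : ℕ) → (ℕ → ℕ) → Set
DVertex n x = Fin n ⊎ Σ (Fin n) (λ i → Fin (x (toℕ i + 1) ∸ 1))

DVertex-≟ : (n : ℕ) (x : ℕ → ℕ) → DecidableEquality (DVertex n x)
DVertex-≟ n x = SumP.≡-dec FinP._≟_ (ProdP.≡-dec FinP._≟_ FinP._≟_)

bondEdges : (n : ℕ) (x y : ℕ → ℕ) → List (DVertex n x × DVertex n x)
bondEdges zero    x y = []
bondEdges (suc m) x y =
  concatMap (λ i → replicate (y (toℕ i + 1)) (inj₁ (inject₁ i) , inj₁ (fsuc i))) (allFin m)

leafEdges : (n : ℕ) (x : ℕ → ℕ) → List (DVertex n x × DVertex n x)
leafEdges n x =
  concatMap (λ i → map (λ j → (inj₁ i , inj₂ (i , j))) (allFin (x (toℕ i + 1) ∸ 1))) (allFin n)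

D : (n : ℕ) (x y : ℕ → ℕ) → Multigraph
D n x y = record
  { V     = DVertex n x
  ; _≟V_  = DVertex-≟ n x
  ; edges = bondEdges n x y ++ leafEdges n x
  }

numer : (a b : ℕ → ℕ) → ℕ → ℕ
numer a b zero                = a 0
numer a b (suc zero)          = a 0 * a 1 + b 1
numer a b (suc (suc k))       = a (suc (suc k)) * numer a b (suc k) + b (suc (suc k)) * numer a b k

-- Proof.  (1) Z G is the number of pairwise disjoint edge sets (Z-as-count).
-- (2) For an arbitrary edge list, these are counted by the deletion recursion
-- Z(G) = Z(G - e) + Z(G - u - v), e = uv, where deleted vertices are recorded by a
-- marking of covered vertices (module Matchings); the recursion is invariant under
-- injective renaming of vertices (module Renaming), so we may rename the vertices
-- of D_n into W = ℕ ⊎ ℕ × ℕ.  (3) On the renamed edge list (all bond blocks, then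
-- all leaf blocks) the recursion is evaluated explicitly (module Caterpillar):
-- leaves of an uncovered path vertex t contribute a factor a_t, and running
-- through the bond blocks from left to right yields the transfer recursion T,
-- which is the continuant expanded from the front.  (4) Continuants satisfy the
-- front recursion as well as the back recursion defining numer
-- (continuant-front), so T equals numer, which gives the theorem.
module Submission where

open import Defs
open import Data.Nat using (ℕ; _<_; _≤_; _∸_; pred)
open import Relation.Binary.PropositionalEquality using (_≡_)

open import Level using (0ℓ)
open import Data.Nat using (zero; suc; _+_; _*_; z≤n; s≤s; _≟_; _≤?_; >-nonZero)
open import Data.Nat.Properties
  using (suc-pred; +-suc; +-comm; +-identityʳ; *-identityʳ; *-identityˡ; *-assoc; m≤m+n; <⇒≤; <⇒≢; >⇒≢; m<n⇒m<1+n; ≤-refl; ≤-reflexive; ≤-antisym; ≰⇒>; m≤n⇒m≤1+n; n≤0⇒n≡0; n≮n)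
open import Data.Nat.Tactic.RingSolver using (solve-∀)
open import Data.Bool using (Bool; true; false; _∨_)
open import Data.Bool.Properties using (∨-zeroʳ; ∨-identityʳ; ∨-conicalˡ; ∨-conicalʳ)
open import Data.List using (List; []; _∷_; _++_; map; length; filter; lookup; replicate; allFin; concat; tabulate)
open import Data.List.Properties using (map-++; map-replicate; map-∘; ++-assoc; length-tabulate; filter-≐; filter-++; filter-none; length-++)
import Data.List.Relation.Unary.All as All
open import Data.List.Relation.Unary.All using (All; []; _∷_)
open import Data.List.Relation.Unary.All.Properties using (replicate⁺; map⁺; ++⁺)
open import Data.Fin using (Fin; toℕ) renaming (zero to fzero; suc to fsuc)
open import Data.Fin.Properties using (suc-injective; toℕ-injective; toℕ-inject₁)
open import Data.Fin.Subset using (Subset; _∈_; ∣_∣; inside; outside)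
open import Data.Fin.Subset.Properties using (∣p∣≤n)
open import Data.Vec using (here; there) renaming ([] to []ᵥ; _∷_ to _∷ᵥ_)
open import Data.Product using (_×_; _,_; proj₁; proj₂)
import Data.Product.Properties as ProdP
open import Data.Sum using (_⊎_; inj₁; inj₂)
import Data.Sum.Properties as SumP
open import Data.Empty using (⊥-elim)
open import Function using (_∘_; id)
open import Relation.Binary.PropositionalEquality
  using (_≢_; ≢-sym; refl; sym; trans; cong; cong₂; subst; module ≡-Reasoning)
open import Relation.Binary.Definitions using (DecidableEquality)
open import Relation.Nullary using (yes; no; does; ¬_)
open import Relation.Nullary.Decidable using (_×-dec_; dec-true; dec-false)
import Relation.Nullary.Decidable as Dec
open import Function.Bundles using (_⇔_; mk⇔; module Equivalence)
open import Relation.Unary using (Pred; Decidable; _≐_)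
open import Relation.Unary.Properties using (_∩?_; ∁?)

count : {A : Set} {P : Pred A 0ℓ} → Decidable P → List A → ℕ
count P? xs = length (filter P? xs)

module _ {A : Set} where

  count-≐ : {P Q : Pred A 0ℓ} (P? : Decidable P) (Q? : Decidable Q) → P ≐ Q →
    ∀ xs → count P? xs ≡ count Q? xs
  count-≐ P? Q? P≐Q xs = cong length (filter-≐ P? Q? P≐Q xs)

  count-++ : {P : Pred A 0ℓ} (P? : Decidable P) → ∀ xs ys →
    count P? (xs ++ ys) ≡ count P? xs + count P? ys
  count-++ P? xs ys = trans (cong length (filter-++ P? xs ys)) (length-++ (filter P? xs))

  count-none : {P : Pred A 0ℓ} (P? : Decidable P) → (∀ x → ¬ P x) → ∀ xs → count P? xs ≡ 0
  count-none P? ¬P xs = cong length (filter-none P? (All.universal ¬P xs))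

  count-split : {P Q : Pred A 0ℓ} (P? : Decidable P) (Q? : Decidable Q) → ∀ xs →
    count P? xs ≡ count (P? ∩? Q?) xs + count (P? ∩? ∁? Q?) xs
  count-split P? Q? [] = refl
  count-split P? Q? (x ∷ xs) with P? x | Q? x
  ... | no _  | _     = count-split P? Q? xs
  ... | yes _ | yes _ = cong suc (count-split P? Q? xs)
  ... | yes _ | no _  = trans (cong suc (count-split P? Q? xs)) (sym (+-suc _ _))

module _ {A B : Set} where

  count-map : {P : Pred B 0ℓ} (P? : Decidable P) (f : A → B) → ∀ xs →
    count P? (map f xs) ≡ count (P? ∘ f) xs
  count-map P? f [] = refl
  count-map P? f (x ∷ xs) with P? (f x)
  ... | yes _ = cong suc (count-map P? f xs)
  ... | no _  = count-map P? f xs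

sum-count-levels : {A : Set} {P : Pred A 0ℓ} (P? : Decidable P) (f : A → ℕ) (xs : List A) (K : ℕ) →
  sumUpTo (λ k → count (λ x → P? x ×-dec (f x ≟ k)) xs) K ≡ count (λ x → P? x ×-dec (f x ≤? K)) xs
sum-count-levels P? f xs zero =
  count-≐ _ _ ((λ (p , e) → p , ≤-reflexive e) , (λ (p , l) → p , n≤0⇒n≡0 l)) xs
sum-count-levels {P = P} P? f xs (suc K) = begin
  sumUpTo level K + level (suc K)
    ≡⟨ cong (_+ level (suc K)) (sum-count-levels P? f xs K) ⟩
  count (atMost K) xs + level (suc K)
    ≡⟨ cong₂ _+_ (count-≐ _ _ below xs) (count-≐ _ _ top xs) ⟩
  count (atMost (suc K) ∩? (λ x → f x ≤? K)) xs + count (atMost (suc K) ∩? ∁? (λ x → f x ≤? K)) xs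
    ≡⟨ sym (count-split (atMost (suc K)) (λ x → f x ≤? K) xs) ⟩
  count (atMost (suc K)) xs ∎
  where
  open ≡-Reasoning
  level : ℕ → ℕ
  level k = count (λ x → P? x ×-dec (f x ≟ k)) xs
  atMost : (k : ℕ) → Decidable (λ x → P x × f x ≤ k)
  atMost k x = P? x ×-dec (f x ≤? k)
  below : (λ x → P x × f x ≤ K) ≐ (λ x → (P x × f x ≤ suc K) × f x ≤ K)
  below = (λ (p , l) → (p , m≤n⇒m≤1+n l) , l) , (λ ((p , _) , l) → p , l)
  top : (λ x → P x × f x ≡ suc K) ≐ (λ x → (P x × f x ≤ suc K) × ¬ f x ≤ K)
  top = (λ (p , e) → (p , ≤-reflexive e) , λ l → n≮n K (subst (_≤ K) e l))
      , (λ ((p , l) , nl) → p , ≤-antisym l (≰⇒> nl))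

-- Z G counts all pairwise disjoint edge sets: none of them has more than |E(G)| edges.
Z-as-count : (G : Multigraph) → Z G ≡ count (pairwiseDisjoint? G) (allSubsets (E G))
Z-as-count G = trans (sum-count-levels (pairwiseDisjoint? G) ∣_∣ (allSubsets (E G)) (E G))
  (count-≐ _ _ (proj₁ , λ {S} pd → pd , ∣p∣≤n S) (allSubsets (E G)))

-- Matchings of a list of edges, counted by the deletion recursion
-- Z(G) = Z(G - e) + Z(G - u - v) for an edge e = uv.  Deleted vertices are
-- recorded by a marking of covered vertices instead of being removed.
module Matchings {V : Set} (_≟V_ : DecidableEquality V) where

  Edge : Set
  Edge = V × V

  Marking : Set
  Marking = V → Bool

  cover : Marking → V → V → Marking
  cover U u v w = U w ∨ does (w ≟V u) ∨ does (w ≟V v)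

  whenFree : Bool → Bool → ℕ → ℕ
  whenFree false false n = n
  whenFree _     _     _ = 0

  -- number of matchings of es avoiding the covered vertices: the first edge
  -- is either unused, or used (only if both endpoints are uncovered)
  match# : Marking → List Edge → ℕ
  match# U []             = 1
  match# U ((u , v) ∷ es) = match# U es + whenFree (U u) (U v) (match# (cover U u v) es)

  cover-left : ∀ U u v → cover U u v u ≡ true
  cover-left U u v = trans (cong (λ b → U u ∨ b ∨ does (u ≟V v)) (dec-true (u ≟V u) refl)) (∨-zeroʳ (U u))

  cover-right : ∀ U u v → cover U u v v ≡ true
  cover-right U u v =
    trans (cong (λ b → U v ∨ does (v ≟V u) ∨ b) (dec-true (v ≟V v) refl))
      (trans (cong (U v ∨_) (∨-zeroʳ (does (v ≟V u)))) (∨-zeroʳ (U v)))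

  cover-other : ∀ U {u v w} → w ≢ u → w ≢ v → cover U u v w ≡ U w
  cover-other U {u} {v} {w} w≢u w≢v =
    trans (cong₂ (λ b c → U w ∨ b ∨ c) (dec-false (w ≟V u) w≢u) (dec-false (w ≟V v) w≢v)) (∨-identityʳ (U w))

  true≢false : true ≢ false
  true≢false ()

  ≢-from-does : ∀ {w u} → does (w ≟V u) ≡ false → w ≢ u
  ≢-from-does {w} {u} h w≡u with w ≟V u | h
  ... | no w≢u | _ = w≢u w≡u

  cover-uncovered : ∀ U u v w → cover U u v w ≡ false → U w ≡ false × w ≢ u × w ≢ v
  cover-uncovered U u v w h =
    ∨-conicalˡ (U w) _ h , ≢-from-does (∨-conicalˡ _ _ rest) , ≢-from-does (∨-conicalʳ _ _ rest)
    where
    rest : does (w ≟V u) ∨ does (w ≟V v) ≡ false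
    rest = ∨-conicalʳ (U w) _ h

  AgreeOn : Marking → Marking → Edge → Set
  AgreeOn U U' (u , v) = U u ≡ U' u × U v ≡ U' v

  match#-cong : ∀ es U U' → All (AgreeOn U U') es → match# U es ≡ match# U' es
  match#-cong []             U U' []               = refl
  match#-cong ((u , v) ∷ es) U U' ((eu , ev) ∷ ags) =
    cong₂ _+_ (match#-cong es U U' ags)
      (trans (cong₂ (λ bu bv → whenFree bu bv (match# (cover U u v) es)) eu ev)
             (cong (whenFree (U' u) (U' v)) (match#-cong es (cover U u v) (cover U' u v) (All.map covered ags))))
    where
    covered : ∀ {e} → AgreeOn U U' e → AgreeOn (cover U u v) (cover U' u v) e
    covered (ea , eb) = cong (_∨ _) ea , cong (_∨ _) eb

  Blocked : Marking → Edge → Set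
  Blocked U (u , _) = U u ≡ true

  match#-skip : ∀ L R U → All (Blocked U) L → match# U (L ++ R) ≡ match# U R
  match#-skip []            R U []       = refl
  match#-skip ((u , v) ∷ L) R U (b ∷ bs) rewrite b = trans (+-identityʳ _) (match#-skip L R U bs)

  -- k parallel copies of an edge uv with both ends free: use none, or exactly one of them
  match#-parallel : ∀ k u v R U → U u ≡ false → U v ≡ false →
    match# U (replicate k (u , v) ++ R) ≡ match# U R + k * match# (cover U u v) R
  match#-parallel zero    u v R U fu fv = sym (+-identityʳ _)
  match#-parallel (suc k) u v R U fu fv rewrite fu | fv =
    trans (cong₂ _+_ (match#-parallel k u v R U fu fv)
                     (match#-skip (replicate k (u , v)) R (cover U u v) (replicate⁺ k (cover-left U u v))))
          (shuffle (match# U R) k (match# (cover U u v) R))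
    where
    shuffle : ∀ c k d → (c + k * d) + d ≡ c + (d + k * d)
    shuffle = solve-∀

  Free : Marking → Edge → Set
  Free U (u , v) = U u ≡ false × U v ≡ false

  DisjointEdges : (es : List Edge) → Subset (length es) → Set
  DisjointEdges es S = ∀ i j → i ∈ S → j ∈ S → i ≢ j → Disjoint (lookup es i) (lookup es j)

  AvoidingMatching : Marking → (es : List Edge) → Subset (length es) → Set
  AvoidingMatching U es S = DisjointEdges es S × (∀ i → i ∈ S → Free U (lookup es i))

  disjoint-sym : (e f : Edge) → Disjoint e f → Disjoint f e
  disjoint-sym _ _ (d₁ , d₂ , d₃ , d₄) = ≢-sym d₁ , ≢-sym d₃ , ≢-sym d₂ , ≢-sym d₄

  free-after-cover : ∀ U u v (f : Edge) → Free U f → Disjoint (u , v) f → Free (cover U u v) f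
  free-after-cover U u v (u' , v') (fu , fv) (d₁ , d₂ , d₃ , d₄) =
    trans (cover-other U (≢-sym d₁) (≢-sym d₃)) fu , trans (cover-other U (≢-sym d₂) (≢-sym d₄)) fv

  free-before-cover : ∀ U u v (f : Edge) → Free (cover U u v) f → Free U f × Disjoint (u , v) f
  free-before-cover U u v (u' , v') (fu , fv)
    with cover-uncovered U u v u' fu | cover-uncovered U u v v' fv
  ... | (fu' , u'≢u , u'≢v) | (fv' , v'≢u , v'≢v) =
    (fu' , fv') , ≢-sym u'≢u , ≢-sym v'≢u , ≢-sym u'≢v , ≢-sym v'≢v

  disjoint-tail : ∀ {e es b S} → DisjointEdges (e ∷ es) (b ∷ᵥ S) → DisjointEdges es S
  disjoint-tail pd i j i∈S j∈S i≢j = pd (fsuc i) (fsuc j) (there i∈S) (there j∈S) (i≢j ∘ suc-injective)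

  unused-first : ∀ U e es S → AvoidingMatching U (e ∷ es) (outside ∷ᵥ S) ⇔ AvoidingMatching U es S
  unused-first U e es S = mk⇔
    (λ (pd , fr) → disjoint-tail pd , λ i i∈S → fr (fsuc i) (there i∈S))
    (λ (pd , fr) → disjoint pd , free fr)
    where
    disjoint : DisjointEdges es S → DisjointEdges (e ∷ es) (outside ∷ᵥ S)
    disjoint pd (fsuc i) (fsuc j) (there i∈S) (there j∈S) i≢j = pd i j i∈S j∈S (i≢j ∘ cong fsuc)
    free : (∀ i → i ∈ S → Free U (lookup es i)) → ∀ i → i ∈ outside ∷ᵥ S → Free U (lookup (e ∷ es) i)
    free fr (fsuc i) (there i∈S) = fr i i∈S

  used-first : ∀ U u v es S →
    AvoidingMatching U ((u , v) ∷ es) (inside ∷ᵥ S) ⇔ (Free U (u , v) × AvoidingMatching (cover U u v) es S)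
  used-first U u v es S = mk⇔
    (λ (pd , fr) → fr fzero here , disjoint-tail pd ,
       λ i i∈S → free-after-cover U u v (lookup es i) (fr (fsuc i) (there i∈S))
                   (pd fzero (fsuc i) here (there i∈S) λ ()))
    (λ (fruv , pd , fr) → disjoint pd fr , free fruv fr)
    where
    disjoint : DisjointEdges es S → (∀ i → i ∈ S → Free (cover U u v) (lookup es i)) →
      DisjointEdges ((u , v) ∷ es) (inside ∷ᵥ S)
    disjoint pd fr fzero    fzero    _     _           ne = ⊥-elim (ne refl)
    disjoint pd fr fzero    (fsuc j) _     (there j∈S) _  =
      proj₂ (free-before-cover U u v (lookup es j) (fr j j∈S))
    disjoint pd fr (fsuc i) fzero    (there i∈S) _     _  =
      disjoint-sym (u , v) (lookup es i) (proj₂ (free-before-cover U u v (lookup es i) (fr i i∈S)))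
    disjoint pd fr (fsuc i) (fsuc j) (there i∈S) (there j∈S) ne = pd i j i∈S j∈S (ne ∘ cong fsuc)
    free : Free U (u , v) → (∀ i → i ∈ S → Free (cover U u v) (lookup es i)) →
      ∀ i → i ∈ inside ∷ᵥ S → Free U (lookup ((u , v) ∷ es) i)
    free fruv fr fzero    here        = fruv
    free fruv fr (fsuc i) (there i∈S) = proj₁ (free-before-cover U u v (lookup es i) (fr i i∈S))

  nothing-covered : ∀ es S → AvoidingMatching (λ _ → false) es S ⇔ DisjointEdges es S
  nothing-covered es S = mk⇔ proj₁ (λ pd → pd , λ _ _ → refl , refl)

  match#-counts : ∀ es U (A? : Decidable (AvoidingMatching U es)) →
    count A? (allSubsets (length es)) ≡ match# U es
  match#-counts [] U A? with A? []ᵥ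
  ... | yes _ = refl
  ... | no ¬A = ⊥-elim (¬A ((λ ()) , (λ ())))
  match#-counts ((u , v) ∷ es) U A? = begin
    count A? (map (outside ∷ᵥ_) Ss ++ map (inside ∷ᵥ_) Ss)
      ≡⟨ count-++ A? (map (outside ∷ᵥ_) Ss) _ ⟩
    count A? (map (outside ∷ᵥ_) Ss) + count A? (map (inside ∷ᵥ_) Ss)
      ≡⟨ cong₂ _+_ (count-map A? _ Ss) (count-map A? _ Ss) ⟩
    count (A? ∘ (outside ∷ᵥ_)) Ss + count (A? ∘ (inside ∷ᵥ_)) Ss
      ≡⟨ cong₂ _+_ unused used ⟩
    match# U es + whenFree (U u) (U v) (match# (cover U u v) es) ∎
    where
    open ≡-Reasoning
    Ss = allSubsets (length es)
    module Unused {S} = Equivalence (unused-first U (u , v) es S)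
    module Used {S} = Equivalence (used-first U u v es S)
    unused : count (A? ∘ (outside ∷ᵥ_)) Ss ≡ match# U es
    unused = trans (count-≐ _ rest? (Unused.to , Unused.from) Ss) (match#-counts es U rest?)
      where
      rest? : Decidable (AvoidingMatching U es)
      rest? S = Dec.map (unused-first U (u , v) es S) (A? (outside ∷ᵥ S))
    used : count (A? ∘ (inside ∷ᵥ_)) Ss ≡ whenFree (U u) (U v) (match# (cover U u v) es)
    used with U u in eu | U v in ev
    ... | false | false = trans (count-≐ _ rest? (proj₂ ∘ Used.to , λ A → Used.from (fruv , A)) Ss)
                                (match#-counts es (cover U u v) rest?)
      where
      fruv : Free U (u , v)
      fruv = eu , ev
      rest? : Decidable (AvoidingMatching (cover U u v) es)
      rest? S = Dec.map′ (proj₂ ∘ Used.to) (λ A → Used.from (fruv , A)) (A? (inside ∷ᵥ S))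
    ... | true  | _    = count-none _ (λ S A → true≢false (trans (sym eu) (proj₁ (proj₁ (Used.to A))))) Ss
    ... | false | true = count-none _ (λ S A → true≢false (trans (sym ev) (proj₂ (proj₁ (Used.to A))))) Ss

module Renaming {V W : Set} (_≟V_ : DecidableEquality V) (_≟W_ : DecidableEquality W)
  (φ : V → W) (φ-injective : ∀ {a b} → φ a ≡ φ b → a ≡ b) where
  module MV = Matchings _≟V_
  module MW = Matchings _≟W_

  rename : V × V → W × W
  rename (u , v) = φ u , φ v

  does-φ : ∀ a b → does (a ≟V b) ≡ does (φ a ≟W φ b)
  does-φ a b with a ≟V b | φ a ≟W φ b
  ... | yes _   | yes _   = refl
  ... | yes a≡b | no ¬φ   = ⊥-elim (¬φ (cong φ a≡b))
  ... | no a≢b  | yes φ≡  = ⊥-elim (a≢b (φ-injective φ≡))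
  ... | no _    | no _    = refl

  match#-rename : ∀ es (U : MV.Marking) (U' : MW.Marking) → (∀ w → U w ≡ U' (φ w)) →
    MV.match# U es ≡ MW.match# U' (map rename es)
  match#-rename []             U U' U≡U'∘φ = refl
  match#-rename ((u , v) ∷ es) U U' U≡U'∘φ rewrite U≡U'∘φ u | U≡U'∘φ v =
    cong₂ _+_ (match#-rename es U U' U≡U'∘φ)
      (cong (MW.whenFree (U' (φ u)) (U' (φ v)))
            (match#-rename es (MV.cover U u v) (MW.cover U' (φ u) (φ v)) covered))
    where
    covered : ∀ w → MV.cover U u v w ≡ MW.cover U' (φ u) (φ v) (φ w)
    covered w rewrite U≡U'∘φ w | does-φ w u | does-φ w v = refl

-- Continuants: continuant a b k is the numerator of the convergent with partial
-- quotients a 0, …, a (k-1) (and 1 for the empty one).  By definition of numer it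
-- obeys the recursion from the back; the transfer recursion along the caterpillar
-- produces it from the front, so we also need the front recursion.
continuant : (ℕ → ℕ) → (ℕ → ℕ) → ℕ → ℕ
continuant a b zero    = 1
continuant a b (suc k) = numer a b k

-- the back recursion, which for k = 0 also covers the explicit case numer a b 1
continuant-back : ∀ a b k →
  continuant a b (2 + k) ≡ a (suc k) * continuant a b (suc k) + b (suc k) * continuant a b k
continuant-back a b zero    = swap (a 0) (a 1) (b 1)
  where
  swap : ∀ a₀ a₁ b₁ → a₀ * a₁ + b₁ ≡ a₁ * a₀ + b₁ * 1
  swap = solve-∀
continuant-back a b (suc k) = refl

continuant-front : ∀ r a b → continuant a b (2 + r) ≡
  a 0 * continuant (a ∘ suc) (b ∘ suc) (suc r) + b 1 * continuant (a ∘ suc ∘ suc) (b ∘ suc ∘ suc) r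
continuant-front zero a b = pad (a 0) (a 1) (b 1)
  where
  pad : ∀ a₀ a₁ b₁ → a₀ * a₁ + b₁ ≡ a₀ * a₁ + b₁ * 1
  pad = solve-∀
continuant-front (suc zero) a b = expand (a 0) (a 1) (a 2) (b 1) (b 2)
  where
  expand : ∀ a₀ a₁ a₂ b₁ b₂ → a₂ * (a₀ * a₁ + b₁) + b₂ * a₀ ≡ a₀ * (a₁ * a₂ + b₂) + b₁ * a₂
  expand = solve-∀
continuant-front (suc (suc r)) a b = begin
  aₗ * continuant a b (3 + r) + bₗ * continuant a b (2 + r)
    ≡⟨ cong₂ (λ p q → aₗ * p + bₗ * q) (continuant-front (suc r) a b) (continuant-front r a b) ⟩
  aₗ * (a 0 * A (2 + r) + b 1 * B (1 + r)) + bₗ * (a 0 * A (1 + r) + b 1 * B r)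
    ≡⟨ regroup (a 0) (b 1) aₗ bₗ (A (2 + r)) (B (1 + r)) (A (1 + r)) (B r) ⟩
  a 0 * A (3 + r) + b 1 * (aₗ * B (1 + r) + bₗ * B r)
    ≡⟨ cong (λ z → a 0 * A (3 + r) + b 1 * z) (sym (continuant-back (a ∘ suc ∘ suc) (b ∘ suc ∘ suc) r)) ⟩
  a 0 * A (3 + r) + b 1 * B (2 + r) ∎
  where
  open ≡-Reasoning
  aₗ = a (3 + r)
  bₗ = b (3 + r)
  A B : ℕ → ℕ
  A = continuant (a ∘ suc) (b ∘ suc)
  B = continuant (a ∘ suc ∘ suc) (b ∘ suc ∘ suc)
  regroup : ∀ a₀ b₁ α β X₁ Y₁ X₀ Y₀ → α * (a₀ * X₁ + b₁ * Y₁) + β * (a₀ * X₀ + b₁ * Y₀)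
                                    ≡ a₀ * (α * X₁ + β * X₀) + b₁ * (α * Y₁ + β * Y₀)
  regroup = solve-∀

continuant-cong : ∀ k {a a' b b'} → (∀ i → i < k → a i ≡ a' i) → (∀ i → i < k → b i ≡ b' i) →
  continuant a b k ≡ continuant a' b' k
continuant-cong zero                ea eb = refl
continuant-cong (suc zero)          ea eb = ea 0 (s≤s z≤n)
continuant-cong (suc (suc zero))    ea eb =
  cong₂ _+_ (cong₂ _*_ (ea 0 (s≤s z≤n)) (ea 1 ≤-refl)) (eb 1 ≤-refl)
continuant-cong (suc (suc (suc k))) ea eb =
  cong₂ _+_ (cong₂ _*_ (ea _ ≤-refl) (continuant-cong (suc (suc k)) (below ea) (below eb)))
            (cong₂ _*_ (eb _ ≤-refl) (continuant-cong (suc k) (below (below ea)) (below (below eb))))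
  where
  below : ∀ {n} {f g : ℕ → ℕ} → (∀ i → i < suc n → f i ≡ g i) → ∀ i → i < n → f i ≡ g i
  below e i i<n = e i (m≤n⇒m≤1+n i<n)

shift-swap : ∀ s t i → s + t + i ≡ t + (s + i)
shift-swap = solve-∀

-- Vertices of a caterpillar: inj₁ t is the path vertex at position t (from 0),
-- inj₂ (t , j) the j-th leaf attached to it.
W : Set
W = ℕ ⊎ (ℕ × ℕ)

_≟W_ : DecidableEquality W
_≟W_ = SumP.≡-dec _≟_ (ProdP.≡-dec _≟_ _≟_)

open Matchings _≟W_
  using (Marking; cover; match#; AgreeOn; Blocked; match#-cong; match#-skip; match#-parallel;
         cover-left; cover-right; cover-other)

position : W → ℕ
position (inj₁ t)       = t
position (inj₂ (t , _)) = t

Beyond : ℕ → W × W → Set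
Beyond t (u , v) = t ≤ position u × t ≤ position v

cover-beyond : ∀ U a b t → position a ≡ t → position b ≡ t →
  ∀ e → Beyond (suc t) e → AgreeOn (cover U a b) U e
cover-beyond U a b t pa pb (u , v) (tu , tv) =
  cover-other U (apart tu pa) (apart tu pb) , cover-other U (apart tv pa) (apart tv pb)
  where
  apart : ∀ {w c} → suc t ≤ position w → position c ≡ t → w ≢ c
  apart {w} w>t pc refl = n≮n t (subst (suc t ≤_) pc w>t)

inj₁-≢ : ∀ {s t : ℕ} → s ≢ t → _≢_ {A = W} (inj₁ s) (inj₁ t)
inj₁-≢ s≢t refl = s≢t refl

blocks : {X : Set} → (ℕ → List X) → ℕ → ℕ → List X
blocks h t zero    = []
blocks h t (suc r) = h t ++ blocks h (suc t) r

all-blocks : {X : Set} {P : X → Set} (h : ℕ → List X) → ∀ t r →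
  (∀ s → t ≤ s → All P (h s)) → All P (blocks h t r)
all-blocks h t zero    hs = []
all-blocks h t (suc r) hs = ++⁺ (hs t ≤-refl) (all-blocks h (suc t) r (λ s t<s → hs s (<⇒≤ t<s)))

-- The caterpillar with x(t+1) - 1 leaves at path vertex t and y(t+1) parallel
-- edges between the path vertices t and t+1; its edges are listed as all bond
-- blocks followed by all leaf blocks.
module Caterpillar (x y : ℕ → ℕ) where

  star : ℕ → {c : ℕ} → List (Fin c) → List (W × W)
  star t js = map (λ j → (inj₁ t , inj₂ (t , toℕ j))) js

  leafBlock : ℕ → List (W × W)
  leafBlock t = star t (allFin (x (t + 1) ∸ 1))

  bondBlock : ℕ → List (W × W)
  bondBlock t = replicate (y (t + 1)) (inj₁ t , inj₁ (suc t))

  leaves bonds : ℕ → ℕ → List (W × W)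
  leaves = blocks leafBlock
  bonds  = blocks bondBlock

  -- the number of ways to treat an uncovered path vertex t using its leaf edges only
  weight : ℕ → ℕ
  weight t = suc (x (t + 1) ∸ 1)

  leafFactor : ℕ → Bool → ℕ
  leafFactor t true  = 1
  leafFactor t false = weight t

  leafProduct : Marking → ℕ → ℕ → ℕ
  leafProduct U t zero    = 1
  leafProduct U t (suc r) = leafFactor t (U (inj₁ t)) * leafProduct U (suc t) r

  leafProduct-snoc : ∀ r t U →
    leafProduct U t (suc r) ≡ leafProduct U t r * leafFactor (t + r) (U (inj₁ (t + r)))
  leafProduct-snoc zero    t U rewrite +-identityʳ t = trans (*-identityʳ _) (sym (*-identityˡ _))
  leafProduct-snoc (suc r) t U rewrite +-suc t r =
    trans (cong (leafFactor t (U (inj₁ t)) *_) (leafProduct-snoc r (suc t) U))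
          (sym (*-assoc (leafFactor t (U (inj₁ t))) _ _))

  leafProduct-cong : ∀ r t U U' → (∀ s → s < t + r → U (inj₁ s) ≡ U' (inj₁ s)) →
    leafProduct U t r ≡ leafProduct U' t r
  leafProduct-cong zero    t U U' e = refl
  leafProduct-cong (suc r) t U U' e =
    cong₂ _*_ (cong (leafFactor t) (e t (subst (t <_) (sym (+-suc t r)) (s≤s (m≤m+n t r)))))
              (leafProduct-cong r (suc t) U U' (λ s s< → e s (subst (s <_) (sym (+-suc t r)) s<)))

  -- no leaf is ever covered: leaves are only covered by their own (leaf) edge
  NoLeafCovered : Marking → Set
  NoLeafCovered U = ∀ s j → U (inj₂ (s , j)) ≡ false

  beyond-leaves : ∀ t r → All (Beyond t) (leaves t r)
  beyond-leaves t r =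
    all-blocks leafBlock t r (λ s t≤s → map⁺ (All.universal (λ _ → t≤s , t≤s) (allFin (x (s + 1) ∸ 1))))

  -- a star at an uncovered path vertex t: use none or exactly one of its edges
  star-count : ∀ t {c} (js : List (Fin c)) U R → U (inj₁ t) ≡ false → NoLeafCovered U →
    All (Beyond (suc t)) R → match# U (star t js ++ R) ≡ suc (length js) * match# U R
  star-count t []       U R ut nl bR = sym (+-identityʳ _)
  star-count t (j ∷ js) U R ut nl bR rewrite ut | nl t (toℕ j) = begin
    match# U (star t js ++ R) + match# U' (star t js ++ R)
      ≡⟨ cong₂ _+_ (star-count t js U R ut nl bR) (match#-skip (star t js) R U' t-covered) ⟩
    suc (length js) * match# U R + match# U' R
      ≡⟨ cong (suc (length js) * match# U R +_) (match#-cong R U' U (All.map (cover-beyond U _ _ t refl refl _) bR)) ⟩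
    suc (length js) * match# U R + match# U R
      ≡⟨ +-comm (suc (length js) * match# U R) _ ⟩
    suc (suc (length js)) * match# U R ∎
    where
    open ≡-Reasoning
    U' = cover U (inj₁ t) (inj₂ (t , toℕ j))
    t-covered : All (Blocked U') (star t js)
    t-covered = map⁺ (All.universal (λ _ → cover-left U (inj₁ t) (inj₂ (t , toℕ j))) js)

  leafBlock-count : ∀ t U R → NoLeafCovered U → All (Beyond (suc t)) R →
    match# U (leafBlock t ++ R) ≡ leafFactor t (U (inj₁ t)) * match# U R
  leafBlock-count t U R nl bR with U (inj₁ t) in ut
  ... | true  = trans (match#-skip (leafBlock t) R U (map⁺ (All.universal (λ _ → ut) _)))
                      (sym (+-identityʳ _))
  ... | false = trans (star-count t (allFin (x (t + 1) ∸ 1)) U R ut nl bR)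
                      (cong (λ n → suc n * match# U R) (length-tabulate {n = x (t + 1) ∸ 1} id))

  leaves-count : ∀ r t U → NoLeafCovered U → match# U (leaves t r) ≡ leafProduct U t r
  leaves-count zero    t U nl = refl
  leaves-count (suc r) t U nl =
    trans (leafBlock-count t U (leaves (suc t) r) nl (beyond-leaves (suc t) r))
          (cong (leafFactor t (U (inj₁ t)) *_) (leaves-count r (suc t) U nl))

  -- while the bonds from position t on are processed, no leaf and no path
  -- vertex beyond t is covered
  Fresh : ℕ → Marking → Set
  Fresh t U = NoLeafCovered U × (∀ s → t < s → U (inj₁ s) ≡ false)

  fresh-suc : ∀ {t} U → Fresh t U → Fresh (suc t) U
  fresh-suc U (nl , up) = nl , λ s t+1<s → up s (<⇒≤ t+1<s)

  fresh-cover : ∀ {t} U → Fresh t U → Fresh (suc t) (cover U (inj₁ t) (inj₁ (suc t)))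
  fresh-cover {t} U (nl , up) =
    (λ s j → trans (cover-other U {inj₁ t} {inj₁ (suc t)} (λ ()) (λ ())) (nl s j)) ,
    (λ s t+1<s → trans (cover-other U (inj₁-≢ (>⇒≢ (<⇒≤ t+1<s))) (inj₁-≢ (>⇒≢ t+1<s))) (up s (<⇒≤ t+1<s)))

  leafProduct-cover : ∀ t U → leafProduct (cover U (inj₁ t) (inj₁ (suc t))) 0 t ≡ leafProduct U 0 t
  leafProduct-cover t U = leafProduct-cong t 0 (cover U (inj₁ t) (inj₁ (suc t))) U
    (λ s s<t → cover-other U (inj₁-≢ (<⇒≢ s<t)) (inj₁-≢ (<⇒≢ (m<n⇒m<1+n s<t))))

  -- T t r b: matchings of the part of the caterpillar at positions t, …, t+r,
  -- where path vertex t is already covered iff b (transfer recursion along the path)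
  T : ℕ → ℕ → Bool → ℕ
  T t zero    b     = leafFactor t b
  T t (suc r) true  = T (suc t) r false
  T t (suc r) false = weight t * T (suc t) r false + y (t + 1) * T (suc t) r true

  -- The bond block at t, given the count (ih) of the edges R that follow it: the
  -- bonds t(t+1) are unusable if t is covered, otherwise at most one is used.
  bond-step : ∀ r t U R → Fresh t U →
    (∀ U → Fresh (suc t) U → match# U R ≡ leafProduct U 0 (suc t) * T (suc t) r (U (inj₁ (suc t)))) →
    match# U (bondBlock t ++ R) ≡ leafProduct U 0 t * T t (suc r) (U (inj₁ t))
  bond-step r t U R fr ih = by-cases (U (inj₁ t)) refl
    where
    open ≡-Reasoning
    P = leafProduct U 0 t
    U' = cover U (inj₁ t) (inj₁ (suc t))
    t+1-free : U (inj₁ (suc t)) ≡ false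
    t+1-free = proj₂ fr (suc t) ≤-refl
    after-bond : ∀ U → Fresh (suc t) U →
      match# U R ≡ leafProduct U 0 t * leafFactor t (U (inj₁ t)) * T (suc t) r (U (inj₁ (suc t)))
    after-bond U fr = trans (ih U fr) (cong (_* T (suc t) r (U (inj₁ (suc t)))) (leafProduct-snoc t 0 U))
    by-cases : ∀ b → U (inj₁ t) ≡ b → match# U (bondBlock t ++ R) ≡ P * T t (suc r) b
    by-cases true ut = begin
      match# U (bondBlock t ++ R)
        ≡⟨ match#-skip (bondBlock t) R U (replicate⁺ _ ut) ⟩
      match# U R
        ≡⟨ after-bond U (fresh-suc U fr) ⟩
      P * leafFactor t (U (inj₁ t)) * T (suc t) r (U (inj₁ (suc t)))
        ≡⟨ cong₂ (λ b c → P * leafFactor t b * T (suc t) r c) ut t+1-free ⟩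
      P * 1 * T (suc t) r false
        ≡⟨ cong (_* T (suc t) r false) (*-identityʳ P) ⟩
      P * T (suc t) r false ∎
    by-cases false ut = begin
      match# U (bondBlock t ++ R)
        ≡⟨ match#-parallel (y (t + 1)) (inj₁ t) (inj₁ (suc t)) R U ut t+1-free ⟩
      match# U R + y (t + 1) * match# U' R
        ≡⟨ cong₂ (λ p q → p + y (t + 1) * q) (after-bond U (fresh-suc U fr)) (after-bond U' (fresh-cover U fr)) ⟩
      P * leafFactor t (U (inj₁ t)) * T (suc t) r (U (inj₁ (suc t)))
        + y (t + 1) * (leafProduct U' 0 t * leafFactor t (U' (inj₁ t)) * T (suc t) r (U' (inj₁ (suc t))))
        ≡⟨ cong₂ (λ p q → p + y (t + 1) * q)
             (cong₂ (λ b c → P * leafFactor t b * T (suc t) r c) ut t+1-free)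
             (cong₂ (λ p b → p * leafFactor t b * T (suc t) r (U' (inj₁ (suc t))))
                    (leafProduct-cover t U) (cover-left U (inj₁ t) (inj₁ (suc t)))) ⟩
      P * weight t * T (suc t) r false + y (t + 1) * (P * 1 * T (suc t) r (U' (inj₁ (suc t))))
        ≡⟨ cong (λ c → P * weight t * T (suc t) r false + y (t + 1) * (P * 1 * T (suc t) r c))
                (cover-right U (inj₁ t) (inj₁ (suc t))) ⟩
      P * weight t * T (suc t) r false + y (t + 1) * (P * 1 * T (suc t) r true)
        ≡⟨ factor P (weight t) (y (t + 1)) _ _ ⟩
      P * (weight t * T (suc t) r false + y (t + 1) * T (suc t) r true) ∎
      where
      factor : ∀ P w c F G → P * w * F + c * (P * 1 * G) ≡ P * (w * F + c * G)
      factor = solve-∀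

  bonds-count : ∀ r t U → Fresh t U →
    match# U (bonds t r ++ leaves 0 (suc (t + r))) ≡ leafProduct U 0 t * T t r (U (inj₁ t))
  bonds-count zero t U (nl , _) rewrite +-identityʳ t =
    trans (leaves-count (suc t) 0 U nl) (leafProduct-snoc t 0 U)
  bonds-count (suc r) t U fr rewrite +-suc t r =
    trans (cong (match# U) (++-assoc (bondBlock t) (bonds (suc t) r) (leaves 0 (suc (suc t + r)))))
          (bond-step r t U _ fr (bonds-count r (suc t)))

  T-free : ∀ r t → T t r false ≡ continuant (λ i → weight (t + i)) (λ i → y (t + i)) (suc r)
  T-covered : ∀ r t → T t r true ≡ continuant (λ i → weight (suc t + i)) (λ i → y (suc t + i)) r

  T-free zero    t = cong weight (sym (+-identityʳ t))
  T-free (suc r) t = begin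
    weight t * T (suc t) r false + y (t + 1) * T (suc t) r true
      ≡⟨ cong₂ (λ p q → weight t * p + y (t + 1) * q) (T-free r (suc t)) (T-covered r (suc t)) ⟩
    weight t * continuant (shifted weight 1) (shifted y 1) (suc r)
      + y (t + 1) * continuant (shifted weight 2) (shifted y 2) r
      ≡⟨ cong₂ _+_ (cong₂ _*_ (cong weight (sym (+-identityʳ t)))
                              (continuant-cong (suc r) (reindex weight 1) (reindex y 1)))
                   (cong (y (t + 1) *_) (continuant-cong r (reindex weight 2) (reindex y 2))) ⟩
    weight (t + 0) * continuant (shifted weight 0 ∘ suc) (shifted y 0 ∘ suc) (suc r)
      + y (t + 1) * continuant (shifted weight 0 ∘ suc ∘ suc) (shifted y 0 ∘ suc ∘ suc) r
      ≡⟨ sym (continuant-front r (shifted weight 0) (shifted y 0)) ⟩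
    continuant (shifted weight 0) (shifted y 0) (2 + r) ∎
    where
    open ≡-Reasoning
    shifted : (ℕ → ℕ) → ℕ → ℕ → ℕ
    shifted f s i = f (s + t + i)
    reindex : ∀ f s {k} i → i < k → f (s + t + i) ≡ f (t + (s + i))
    reindex f s i _ = cong f (shift-swap s t i)

  T-covered zero    t = refl
  T-covered (suc r) t = T-free r (suc t)

map-concat-blocks : {A X : Set} {n : ℕ} (k : ℕ) (g : Fin k → Fin n) (F : Fin n → List A)
  (ψ : A → X) (h : ℕ → List X) (t : ℕ) → (∀ j → map ψ (F (g j)) ≡ h (t + toℕ j)) →
  map ψ (concat (map F (tabulate g))) ≡ blocks h t k
map-concat-blocks zero    g F ψ h t e = refl
map-concat-blocks (suc k) g F ψ h t e =
  trans (map-++ ψ (F (g fzero)) (concat (map F (tabulate (g ∘ fsuc)))))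
        (cong₂ _++_ (trans (e fzero) (cong h (+-identityʳ t)))
                    (map-concat-blocks k (g ∘ fsuc) F ψ h (suc t) (λ j → trans (e (fsuc j)) (cong h (+-suc t (toℕ j))))))

module CaterpillarBond (m : ℕ) (a b : ℕ → ℕ) where
  x : ℕ → ℕ
  x k = a (pred k)

  G : Multigraph
  G = D (suc m) x b

  φ : DVertex (suc m) x → W
  φ (inj₁ i)       = inj₁ (toℕ i)
  φ (inj₂ (i , j)) = inj₂ (toℕ i , toℕ j)

  φ-injective : ∀ {v w} → φ v ≡ φ w → v ≡ w
  φ-injective {inj₁ i} {inj₁ i'} e = cong inj₁ (toℕ-injective (SumP.inj₁-injective e))
  φ-injective {inj₂ (i , j)} {inj₂ (i' , j')} e
    with toℕ-injective {i = i} {j = i'} (proj₁ (ProdP.×-≡,≡←≡ (SumP.inj₂-injective e)))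
  ... | refl = cong (λ k → inj₂ (i , k)) (toℕ-injective (proj₂ (ProdP.×-≡,≡←≡ (SumP.inj₂-injective e))))

  module MV = Matchings (DVertex-≟ (suc m) x)
  open Renaming (DVertex-≟ (suc m) x) _≟W_ φ φ-injective using (rename; match#-rename)
  open Caterpillar x b

  edges-renamed : map rename (edges G) ≡ bonds 0 m ++ leaves 0 (suc m)
  edges-renamed = trans (map-++ rename (bondEdges (suc m) x b) (leafEdges (suc m) x))
    (cong₂ _++_
      (map-concat-blocks m id _ rename bondBlock 0 λ j →
         trans (map-replicate rename _ _)
               (cong (λ s → replicate (b (toℕ j + 1)) (inj₁ s , inj₁ (suc (toℕ j)))) (toℕ-inject₁ j)))
      (map-concat-blocks (suc m) id _ rename leafBlock 0 λ j → sym (map-∘ (allFin (x (toℕ j + 1) ∸ 1)))))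

  none : Marking
  none _ = false

  Z-transfer : Z G ≡ T 0 m false
  Z-transfer = begin
    Z G
      ≡⟨ Z-as-count G ⟩
    count (pairwiseDisjoint? G) (allSubsets (E G))
      ≡⟨ count-≐ _ avoiding? (from , to) (allSubsets (E G)) ⟩
    count avoiding? (allSubsets (E G))
      ≡⟨ MV.match#-counts (edges G) (λ _ → false) avoiding? ⟩
    MV.match# (λ _ → false) (edges G)
      ≡⟨ match#-rename (edges G) (λ _ → false) none (λ _ → refl) ⟩
    match# none (map rename (edges G))
      ≡⟨ cong (match# none) edges-renamed ⟩
    match# none (bonds 0 m ++ leaves 0 (suc m))
      ≡⟨ bonds-count m 0 none ((λ _ _ → refl) , (λ _ _ → refl)) ⟩
    1 * T 0 m false
      ≡⟨ *-identityˡ (T 0 m false) ⟩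
    T 0 m false ∎
    where
    open ≡-Reasoning
    open module NothingCovered {S} = Equivalence (MV.nothing-covered (edges G) S)
    avoiding? : Decidable (MV.AvoidingMatching (λ _ → false) (edges G))
    avoiding? S = Dec.map′ from to (pairwiseDisjoint? G S)

theorem2 : (n : ℕ) → 1 ≤ n → (a b : ℕ → ℕ) →
    (∀ i → i < n → 0 < a i) →
    (∀ i → 1 ≤ i → i < n → 0 < b i) →
    Z (D n (λ k → a (pred k)) b) ≡ numer a b (n ∸ 1)
theorem2 (suc m) _ a b a>0 _ = begin
  Z (D (suc m) x b)              ≡⟨ Z-transfer ⟩
  T 0 m false                    ≡⟨ T-free m 0 ⟩
  continuant weight b (suc m)    ≡⟨ continuant-cong (suc m) weight≡a (λ _ _ → refl) ⟩
  continuant a b (suc m)         ∎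
  where
  open ≡-Reasoning
  open CaterpillarBond m a b
  open Caterpillar x b
  -- with positive partial quotients, a vertex with a_i - 1 leaves has weight a_i
  weight≡a : ∀ i → i < suc m → weight i ≡ a i
  weight≡a i i<n rewrite +-comm i 1 = suc-pred (a i) {{>-nonZero (a>0 i i<n)}}
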